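{- Let $i$ be a positive integer, and define the $2\times4$, $4\times4$, $4\times 4$ matrices \[ A=\begin{bmatrix}1&1&1&1\\1&1&-1&-1\end{bmatrix},\quad B=\begin{bmatrix}1&1&0&0\\-1&-1&0&0\\0&0&1&1\\0&0&-1&-1\end{bmatrix},\quad C=\begin{bmatrix}0&0&-1&1\\0&0&1&-1\\1&-1&0&0\\-1&1&0&0\end{bmatrix}. \] Let $S$ be the $(4i+6)\times(4i+6)$ block matrix with block rows/columns of sizes $2,4,4,\dots,4$ ($i+2$ blocks in total) given by \[ S=\begin{bmatrix} 0 & A & 0 & \cdots & 0 & 0\\ -A^T & 0 & B & \cdots & 0 & 0\\ 0 & -B^T & 0 & \ddots & \vdots & \vdots\\ \vdots & & \ddots & \ddots & B & 0\\ 0 & \cdots & & -B^T & 0 & B\\ 0 & 0 & \cdots & 0 & -B^T & C \end{bmatrix} \] (i.e. the $(1,2)$ block is $A$, the $(2,1)$ block is $-A^T$, the $(k,k+1)$ blocks for $2\le k\le i+1$ are $B$, the $(k+1,k)$ blocks for $2\le k\le i+1$ are $-B^T$, the last diagonal block is $C$, and all other blocks are zero). Then $S$ is the skew-adjacency matrix of an orientation $\mathcal{G}_i^\sigma$ of $\mathcal{G}_i$, with rows/columns ordered $u,v,u_1,u_2,v_1,v_2,u_3,u_4,v_3,v_4,\dots,u_{2i+1},u_{2i+2},v_{2i+1},v_{2i+2}$, and $S^TS=4I$; that is, $\mathcal{G}_i^\sigma$ has optimum skew energy.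
   Context: For a simple graph $G$ on vertices $v_1,\dots,v_n$ with orientation $\sigma$, the skew-adjacency matrix $S(G^\sigma)=[s_{ij}]$ has $s_{ij}=1$, $s_{ji}=-1$ if $\langle v_i,v_j\rangle$ is an arc and $0$ for non-adjacent pairs. Optimum skew energy means the sum of absolute values of the eigenvalues of $S(G^\sigma)$ equals $n\sqrt{\Delta}$ ($\Delta$ the maximum degree), equivalently $S^TS=\Delta I_n$. $\mathcal{G}_i$ is the graph on vertices $u,v,u_1,\dots,u_{2i+2},v_1,\dots,v_{2i+2}$: $u,v$ each adjacent to $u_1,u_2,v_1,v_2$; for $k=1,\dots,i$, each of $u_{2k-1},u_{2k}$ adjacent to each of $u_{2k+1},u_{2k+2}$ and each of $v_{2k-1},v_{2k}$ adjacent to each of $v_{2k+1},v_{2k+2}$; plus edges $u_{2i+1}v_{2i+2},v_{2i+2}u_{2i+2},u_{2i+2}v_{2i+1},v_{2i+1}u_{2i+1}$. -}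

module Defs where

open import Data.Nat as ℕ using (ℕ; zero; suc; _≤_; _∸_; _<ᵇ_; _≡ᵇ_; _≤ᵇ_)
open import Data.Nat.DivMod using (_/_; _mod_)
open import Data.Integer as ℤ using (ℤ; +_; -_; _+_; _*_; 0ℤ; 1ℤ; -1ℤ)
open import Data.Fin using (Fin; zero; suc; toℕ)
open import Data.Fin.Properties using () renaming (_≟_ to _≟ᶠ_)
open import Data.Bool using (Bool; true; false; if_then_else_; _∧_)
open import Data.Sum using (_⊎_)
open import Data.Product using (_×_)
open import Data.Empty using (⊥)
open import Relation.Nullary using (¬_; does)
open import Relation.Binary.PropositionalEquality using (_≡_)

Matrix : ℕ → Set
Matrix n = Fin n → Fin n → ℤ

sumFin : (n : ℕ) → (Fin n → ℤ) → ℤ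
sumFin zero    f = 0ℤ
sumFin (suc n) f = f zero + sumFin n (λ c → f (suc c))

transpose : ∀ {n} → Matrix n → Matrix n
transpose M a b = M b a

_⊗_ : ∀ {n} → Matrix n → Matrix n → Matrix n
_⊗_ {n} M N a b = sumFin n (λ c → M a c * N c b)

identity : ∀ {n} → Matrix n
identity a b = if does (a ≟ᶠ b) then 1ℤ else 0ℤ

record Orientation {n : ℕ} (Adj : Fin n → Fin n → Set) : Set₁ where
  field
    Arc     : Fin n → Fin n → Set
    arc⇒adj : ∀ a b → Arc a b → Adj a b
    adj⇒arc : ∀ a b → Adj a b → Arc a b ⊎ Arc b a
    arc-asym : ∀ a b → Arc a b → Arc b a → ⊥

IsSkewAdjacency : ∀ {n} {Adj : Fin n → Fin n → Set} →
                  Orientation Adj → Matrix n → Set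
IsSkewAdjacency {n} {Adj} σ S =
  ∀ a b → (Arc a b → S a b ≡ 1ℤ)
        × (Arc b a → S a b ≡ -1ℤ)
        × (¬ Adj a b → S a b ≡ 0ℤ)
  where open Orientation σ

data Lab : Set where
  lu lv : Lab
  lU lV : ℕ → Lab     -- lU k = u_k ,  lV k = v_k

-- neighbours u_1,u_2,v_1,v_2 of u and of v
data Hub : Lab → Set where
  hU1 : Hub (lU 1)
  hU2 : Hub (lU 2)
  hV1 : Hub (lV 1)
  hV2 : Hub (lV 2)

-- the listed edges of 𝒢_i (each edge listed in one direction)
data Edge (i : ℕ) : Lab → Lab → Set where
  e-u  : ∀ {x} → Hub x → Edge i lu x
  e-v  : ∀ {x} → Hub x → Edge i lv x
  e-UU : ∀ k a b → 1 ≤ k → k ≤ i →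
         (a ≡ 2 ℕ.* k ∸ 1 ⊎ a ≡ 2 ℕ.* k) →
         (b ≡ 2 ℕ.* k ℕ.+ 1 ⊎ b ≡ 2 ℕ.* k ℕ.+ 2) → Edge i (lU a) (lU b)
  e-VV : ∀ k a b → 1 ≤ k → k ≤ i →
         (a ≡ 2 ℕ.* k ∸ 1 ⊎ a ≡ 2 ℕ.* k) →
         (b ≡ 2 ℕ.* k ℕ.+ 1 ⊎ b ≡ 2 ℕ.* k ℕ.+ 2) → Edge i (lV a) (lV b)
  e-1  : Edge i (lU (2 ℕ.* i ℕ.+ 1)) (lV (2 ℕ.* i ℕ.+ 2))
  e-2  : Edge i (lV (2 ℕ.* i ℕ.+ 2)) (lU (2 ℕ.* i ℕ.+ 2))
  e-3  : Edge i (lU (2 ℕ.* i ℕ.+ 2)) (lV (2 ℕ.* i ℕ.+ 1))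
  e-4  : Edge i (lV (2 ℕ.* i ℕ.+ 1)) (lU (2 ℕ.* i ℕ.+ 1))

AdjL : ℕ → Lab → Lab → Set
AdjL i x y = Edge i x y ⊎ Edge i y x

-- ordering of rows/columns: u, v, u_1,u_2,v_1,v_2, u_3,u_4,v_3,v_4, ...
labelAt : ℕ → Lab
labelAt 0 = lu
labelAt 1 = lv
labelAt (suc (suc p)) = pick ((suc (suc p) ∸ 2) mod 4)
  where
    m : ℕ
    m = p / 4
    pick : Fin 4 → Lab
    pick zero                   = lU (2 ℕ.* m ℕ.+ 1)
    pick (suc zero)             = lU (2 ℕ.* m ℕ.+ 2)
    pick (suc (suc zero))       = lV (2 ℕ.* m ℕ.+ 1)
    pick (suc (suc (suc zero))) = lV (2 ℕ.* m ℕ.+ 2)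

order : ℕ → ℕ
order i = 4 ℕ.* i ℕ.+ 6

Adj𝒢 : (i : ℕ) → Fin (order i) → Fin (order i) → Set
Adj𝒢 i a b = AdjL i (labelAt (toℕ a)) (labelAt (toℕ b))

ι : ℕ → ℤ
ι 0 = 0ℤ
ι 1 = 1ℤ
ι _ = -1ℤ

-- entries coded 0 ↦ 0, 1 ↦ 1, 2 ↦ -1
row4 : ℕ → ℕ → ℕ → ℕ → Fin 4 → ℤ
row4 a b c d zero                   = ι a
row4 a b c d (suc zero)             = ι b
row4 a b c d (suc (suc zero))       = ι c
row4 a b c d (suc (suc (suc zero))) = ι d

Aᵐ : Fin 2 → Fin 4 → ℤ
Aᵐ zero       = row4 1 1 1 1
Aᵐ (suc zero) = row4 1 1 2 2

Bᵐ : Fin 4 → Fin 4 → ℤ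
Bᵐ zero                   = row4 1 1 0 0
Bᵐ (suc zero)             = row4 2 2 0 0
Bᵐ (suc (suc zero))       = row4 0 0 1 1
Bᵐ (suc (suc (suc zero))) = row4 0 0 2 2

Cᵐ : Fin 4 → Fin 4 → ℤ
Cᵐ zero                   = row4 0 0 2 1
Cᵐ (suc zero)             = row4 0 0 1 2
Cᵐ (suc (suc zero))       = row4 1 2 0 0
Cᵐ (suc (suc (suc zero))) = row4 2 1 0 0

-- 0-based block index: block 0 = rows 0,1 (size 2); block m ≥ 1 = rows 4m-2 .. 4m+1
blockOf : ℕ → ℕ
blockOf p = if p <ᵇ 2 then 0 else suc ((p ∸ 2) / 4)

off2 : ℕ → Fin 2
off2 p = p mod 2

off4 : ℕ → Fin 4
off4 p = (p ∸ 2) mod 4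

-- entry (p,q) of S (0-based indices); blocks are 0-based here, so the
-- paper's block k corresponds to block k-1 and the last block is i+1.
Sentry : ℕ → ℕ → ℕ → ℤ
Sentry i p q =
  if (bp ≡ᵇ 0) ∧ (bq ≡ᵇ 1) then Aᵐ (off2 p) (off4 q)
  else if (bp ≡ᵇ 1) ∧ (bq ≡ᵇ 0) then - Aᵐ (off2 q) (off4 p)
  else if (1 ≤ᵇ bp) ∧ (bp ≤ᵇ i) ∧ (bq ≡ᵇ suc bp) then Bᵐ (off4 p) (off4 q)
  else if (1 ≤ᵇ bq) ∧ (bq ≤ᵇ i) ∧ (bp ≡ᵇ suc bq) then - Bᵐ (off4 q) (off4 p)
  else if (bp ≡ᵇ suc i) ∧ (bq ≡ᵇ suc i) then Cᵐ (off4 p) (off4 q)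
  else 0ℤ
  where
    bp bq : ℕ
    bp = blockOf p
    bq = blockOf q

Smat : (i : ℕ) → Matrix (order i)
Smat i a b = Sentry i (toℕ a) (toℕ b)

-- Index rows and columns of S by the hubs u, v and by the layers m = 0, …, i, layer m holding
-- u_{2m+1}, u_{2m+2}, v_{2m+1}, v_{2m+2}; S is then block tridiagonal over the layers.  S is
-- skew-symmetric with entries in {0, ±1} and its nonzero entries are exactly the edges of 𝒢_i,
-- so the +1 entries define the orientation.  For SᵀS = 4I: columns at the hubs or in layer 0
-- only meet the rows of the hubs and the first two layers, where the claim is one of the block
-- identities AAᵀ = 4I, AB = 0, AᵀA + BBᵀ = 4I, BC = 0, BB = 0.  Dropping the hubs and layer 0
-- turns S_{i+1} into S_i with its first block row A replaced by B, which leaves the Gram entries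
-- of the remaining columns unchanged because BᵀB = AᵀA; this induction ends at i = 1 with
-- BᵀB + CᵀC = 4I.
module Submission where

open import Defs
open import Data.Bool using (true; false; if_then_else_; _∧_)
open import Data.Empty using (⊥-elim)
open import Data.Fin using (Fin; zero; suc; toℕ; _↑ˡ_; _↑ʳ_)
open import Data.Fin.Properties using (all?; toℕ-injective; toℕ<n) renaming (_≟_ to _≟ᶠ_)
open import Data.Integer using (ℤ; +_; -_; _+_; _*_; 0ℤ; 1ℤ; -1ℤ)
open import Data.Integer.Properties as ℤ using (_≟_)
open import Data.Nat as ℕ using (ℕ; zero; suc; _≤_; _<_; _∸_; s≤s; z≤n; _<ᵇ_; _≡ᵇ_; _≤ᵇ_)
open import Data.Nat.DivMod using (_/_; _mod_; _divMod_; DivMod; m/n≡1+[m∸n]/n; m<n*o⇒m/o<n)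
import Data.Nat.Properties as ℕ
open import Data.Product using (Σ; _×_; _,_; map₁)
open import Data.Sum using (_⊎_; inj₁; inj₂)
open import Data.Unit using (⊤; tt)
open import Function using (_∘_)
open import Relation.Nullary using (Dec; yes; no; contradiction)
open import Relation.Nullary.Decidable
  using (True; toWitness; ¬?; _⊎-dec_; dec-true; dec-false; decidable-stable)
open import Relation.Binary.PropositionalEquality
open ≡-Reasoning

decide² : ∀ {m n} {P : Fin m → Fin n → Set} (P? : ∀ r s → Dec (P r s)) →
          True (all? λ r → all? (P? r)) → ∀ r s → P r s
decide² P? = toWitness

decide²-≡ : ∀ {m n} {f g : Fin m → Fin n → ℤ} →
            True (all? λ r → all? λ s → f r s ≟ g r s) → ∀ r s → f r s ≡ g r s
decide²-≡ = decide² (λ _ _ → _ ≟ _)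

ZeroOrUnit : ℤ → Set
ZeroOrUnit z = z ≡ 0ℤ ⊎ z ≡ 1ℤ ⊎ z ≡ -1ℤ

zeroOrUnit? : ∀ z → Dec (ZeroOrUnit z)
zeroOrUnit? z = (z ≟ 0ℤ) ⊎-dec (z ≟ 1ℤ) ⊎-dec (z ≟ -1ℤ)

zeroOrUnit-neg : ∀ {z} → ZeroOrUnit z → ZeroOrUnit (- z)
zeroOrUnit-neg (inj₁ refl)        = inj₁ refl
zeroOrUnit-neg (inj₂ (inj₁ refl)) = inj₂ (inj₂ refl)
zeroOrUnit-neg (inj₂ (inj₂ refl)) = inj₂ (inj₁ refl)

skewSignMatrix⇒skewAdjacency :
  ∀ {n} {Adj : Fin n → Fin n → Set} (S : Matrix n) →
  (∀ a b → S b a ≡ - S a b) → (∀ a b → ZeroOrUnit (S a b)) →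
  (∀ a b → Adj a b → S a b ≢ 0ℤ) → (∀ a b → S a b ≢ 0ℤ → Adj a b) →
  Σ (Orientation Adj) (λ σ → IsSkewAdjacency σ S)
skewSignMatrix⇒skewAdjacency {Adj = Adj} S skew zeroOrUnit adj⇒≢0 ≢0⇒adj = σ , λ a b →
  (λ Sab≡1 → Sab≡1) ,
  (λ Sba≡1 → trans (skew b a) (cong -_ Sba≡1)) ,
  (λ ¬adj → decidable-stable (S a b ≟ 0ℤ) (¬adj ∘ ≢0⇒adj a b))
  where
  adj⇒arc : ∀ a b → Adj a b → S a b ≡ 1ℤ ⊎ S b a ≡ 1ℤ
  adj⇒arc a b adj with zeroOrUnit a b
  ... | inj₁ Sab≡0         = ⊥-elim (adj⇒≢0 a b adj Sab≡0)
  ... | inj₂ (inj₁ Sab≡1)  = inj₁ Sab≡1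
  ... | inj₂ (inj₂ Sab≡-1) = inj₂ (trans (skew a b) (cong -_ Sab≡-1))

  σ : Orientation Adj
  σ = record
    { Arc      = λ a b → S a b ≡ 1ℤ
    ; arc⇒adj  = λ a b Sab≡1 → ≢0⇒adj a b λ Sab≡0 → contradiction (trans (sym Sab≡1) Sab≡0) λ ()
    ; adj⇒arc  = adj⇒arc
    ; arc-asym = λ a b Sab≡1 Sba≡1 →
        contradiction (trans (sym Sba≡1) (trans (skew a b) (cong -_ Sab≡1))) λ ()
    }

-- hub r is u (r = 0) or v (r = 1); layer m is the paper's block m + 2.
data Slot : Set where
  hub   : Fin 2 → Slot
  layer : ℕ → Fin 4 → Slot

-- The clauses of tridiag, entry and δ are ordered so that they compute on symbolic layer
-- indices wherever the proofs below rely on it.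
tridiag : ℕ → ℕ → Fin 4 → ℕ → Fin 4 → ℤ
tridiag zero    zero       r zero       s = Cᵐ r s
tridiag (suc i) zero       r (suc zero) s = Bᵐ r s
tridiag (suc i) (suc m)    r (suc n)    s = tridiag i m r n s
tridiag (suc i) (suc zero) r zero       s = - Bᵐ s r
tridiag _       _          _ _          _ = 0ℤ

entry : ℕ → Slot → Slot → ℤ
entry i (hub r)        (layer zero s) = Aᵐ r s
entry i (layer m r)    (layer n s)    = tridiag i m r n s
entry i (layer zero r) (hub s)        = - Aᵐ s r
entry i _              _              = 0ℤ

slotAt : ℕ → Fin 2 → Fin 4 → Slot
slotAt zero    r s = hub r
slotAt (suc m) r s = layer m s

decode : ℕ → Slot
decode p = slotAt (blockOf p) (off2 p) (off4 p)

-- Sentry with the blocks and offsets of both indices abstracted, so that they can be split on.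
Sentryᵇ : ℕ → ℕ → Fin 2 → Fin 4 → ℕ → Fin 2 → Fin 4 → ℤ
Sentryᵇ i bp a r bq b s =
  if (bp ≡ᵇ 0) ∧ (bq ≡ᵇ 1) then Aᵐ a s
  else if (bp ≡ᵇ 1) ∧ (bq ≡ᵇ 0) then - Aᵐ b r
  else if (1 ≤ᵇ bp) ∧ (bp ≤ᵇ i) ∧ (bq ≡ᵇ suc bp) then Bᵐ r s
  else if (1 ≤ᵇ bq) ∧ (bq ≤ᵇ i) ∧ (bp ≡ᵇ suc bq) then - Bᵐ s r
  else if (bp ≡ᵇ suc i) ∧ (bq ≡ᵇ suc i) then Cᵐ r s
  else 0ℤ

tridiagᵇ : ℕ → ℕ → Fin 4 → ℕ → Fin 4 → ℤ
tridiagᵇ i m r n s =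
  if (suc m ≤ᵇ i) ∧ (n ≡ᵇ suc m) then Bᵐ r s
  else if (suc n ≤ᵇ i) ∧ (m ≡ᵇ suc n) then - Bᵐ s r
  else if (m ≡ᵇ i) ∧ (n ≡ᵇ i) then Cᵐ r s
  else 0ℤ

if-∧false : ∀ {A : Set} b (x y : A) → (if b ∧ false then x else y) ≡ y
if-∧false true  x y = refl
if-∧false false x y = refl

tridiagᵇ≡tridiag : ∀ i m r n s → tridiagᵇ i m r n s ≡ tridiag i m r n s
tridiagᵇ≡tridiag zero    zero          r zero          s = refl
tridiagᵇ≡tridiag zero    zero          r (suc n)       s = refl
tridiagᵇ≡tridiag zero    (suc m)       r n             s = refl
tridiagᵇ≡tridiag (suc i) zero          r zero          s = refl
tridiagᵇ≡tridiag (suc i) zero          r (suc zero)    s = refl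
tridiagᵇ≡tridiag (suc i) zero          r (suc (suc n)) s = if-∧false (suc n <ᵇ i) _ _
tridiagᵇ≡tridiag (suc i) (suc zero)    r zero          s = if-∧false (0 <ᵇ i) _ _
tridiagᵇ≡tridiag (suc i) (suc (suc m)) r zero          s =
  trans (if-∧false (suc m <ᵇ i) _ _) (if-∧false (suc m ≡ᵇ i) _ _)
tridiagᵇ≡tridiag (suc i) (suc m)       r (suc n)       s = tridiagᵇ≡tridiag i m r n s

Sentryᵇ≡entry : ∀ i bp a r bq b s →
                Sentryᵇ i bp a r bq b s ≡ entry i (slotAt bp a r) (slotAt bq b s)
Sentryᵇ≡entry i zero          a r zero          b s = refl
Sentryᵇ≡entry i zero          a r (suc zero)    b s = refl
Sentryᵇ≡entry i zero          a r (suc (suc n)) b s = if-∧false (suc n <ᵇ i) _ _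
Sentryᵇ≡entry i (suc zero)    a r zero          b s = refl
Sentryᵇ≡entry i (suc (suc m)) a r zero          b s =
  trans (if-∧false (suc m <ᵇ i) _ _) (if-∧false (suc m ≡ᵇ i) _ _)
Sentryᵇ≡entry i (suc zero)    a r (suc n)       b s = tridiagᵇ≡tridiag i 0 r n s
Sentryᵇ≡entry i (suc (suc m)) a r (suc n)       b s = tridiagᵇ≡tridiag i (suc m) r n s

Sentry≡entry : ∀ i p q → Sentry i p q ≡ entry i (decode p) (decode q)
Sentry≡entry i p q = Sentryᵇ≡entry i (blockOf p) (off2 p) (off4 p) (blockOf q) (off2 q) (off4 q)

C-skew : ∀ r s → Cᵐ s r ≡ - Cᵐ r s
C-skew = decide²-≡ _

tridiag-skew : ∀ i m r n s → tridiag i n s m r ≡ - tridiag i m r n s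
tridiag-skew zero    zero          r zero          s = C-skew r s
tridiag-skew zero    zero          r (suc n)       s = refl
tridiag-skew zero    (suc m)       r zero          s = refl
tridiag-skew zero    (suc m)       r (suc n)       s = refl
tridiag-skew (suc i) zero          r zero          s = refl
tridiag-skew (suc i) zero          r (suc zero)    s = refl
tridiag-skew (suc i) zero          r (suc (suc n)) s = refl
tridiag-skew (suc i) (suc zero)    r zero          s = sym (ℤ.neg-involutive _)
tridiag-skew (suc i) (suc (suc m)) r zero          s = refl
tridiag-skew (suc i) (suc m)       r (suc n)       s = tridiag-skew i m r n s

entry-skew : ∀ i X Y → entry i Y X ≡ - entry i X Y
entry-skew i (hub r)           (hub s)           = refl
entry-skew i (hub r)           (layer zero s)    = refl
entry-skew i (hub r)           (layer (suc n) s) = refl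
entry-skew i (layer zero r)    (hub s)           = sym (ℤ.neg-involutive _)
entry-skew i (layer (suc m) r) (hub s)           = refl
entry-skew i (layer m r)       (layer n s)       = tridiag-skew i m r n s

A-zeroOrUnit : ∀ r s → ZeroOrUnit (Aᵐ r s)
A-zeroOrUnit = decide² (λ r s → zeroOrUnit? (Aᵐ r s)) _

B-zeroOrUnit : ∀ r s → ZeroOrUnit (Bᵐ r s)
B-zeroOrUnit = decide² (λ r s → zeroOrUnit? (Bᵐ r s)) _

C-zeroOrUnit : ∀ r s → ZeroOrUnit (Cᵐ r s)
C-zeroOrUnit = decide² (λ r s → zeroOrUnit? (Cᵐ r s)) _

tridiag-zeroOrUnit : ∀ i m r n s → ZeroOrUnit (tridiag i m r n s)
tridiag-zeroOrUnit zero    zero          r zero          s = C-zeroOrUnit r s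
tridiag-zeroOrUnit zero    zero          r (suc n)       s = inj₁ refl
tridiag-zeroOrUnit zero    (suc m)       r n             s = inj₁ refl
tridiag-zeroOrUnit (suc i) zero          r zero          s = inj₁ refl
tridiag-zeroOrUnit (suc i) zero          r (suc zero)    s = B-zeroOrUnit r s
tridiag-zeroOrUnit (suc i) zero          r (suc (suc n)) s = inj₁ refl
tridiag-zeroOrUnit (suc i) (suc m)       r (suc n)       s = tridiag-zeroOrUnit i m r n s
tridiag-zeroOrUnit (suc i) (suc zero)    r zero          s = zeroOrUnit-neg (B-zeroOrUnit s r)
tridiag-zeroOrUnit (suc i) (suc (suc m)) r zero          s = inj₁ refl

entry-zeroOrUnit : ∀ i X Y → ZeroOrUnit (entry i X Y)
entry-zeroOrUnit i (hub r)           (hub s)           = inj₁ refl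
entry-zeroOrUnit i (hub r)           (layer zero s)    = A-zeroOrUnit r s
entry-zeroOrUnit i (hub r)           (layer (suc n) s) = inj₁ refl
entry-zeroOrUnit i (layer m r)       (layer n s)       = tridiag-zeroOrUnit i m r n s
entry-zeroOrUnit i (layer zero r)    (hub s)           = zeroOrUnit-neg (A-zeroOrUnit s r)
entry-zeroOrUnit i (layer (suc m) r) (hub s)           = inj₁ refl

sumℕ : ℕ → (ℕ → ℤ) → ℤ
sumℕ zero    g = 0ℤ
sumℕ (suc n) g = g 0 + sumℕ n (g ∘ suc)

sumFin-toℕ : ∀ n (g : ℕ → ℤ) → sumFin n (g ∘ toℕ) ≡ sumℕ n g
sumFin-toℕ zero    g = refl
sumFin-toℕ (suc n) g = cong (λ z → g 0 + z) (sumFin-toℕ n (g ∘ suc))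

sumFin-cong : ∀ n {f g : Fin n → ℤ} → (∀ c → f c ≡ g c) → sumFin n f ≡ sumFin n g
sumFin-cong zero    f≗g = refl
sumFin-cong (suc n) f≗g = cong₂ _+_ (f≗g zero) (sumFin-cong n (f≗g ∘ suc))

sumℕ-cong : ∀ n {f g : ℕ → ℤ} → (∀ x → f x ≡ g x) → sumℕ n f ≡ sumℕ n g
sumℕ-cong zero    f≗g = refl
sumℕ-cong (suc n) f≗g = cong₂ _+_ (f≗g 0) (sumℕ-cong n (f≗g ∘ suc))

sumℕ-zero : ∀ n {f : ℕ → ℤ} → (∀ x → f x ≡ 0ℤ) → sumℕ n f ≡ 0ℤ
sumℕ-zero zero    f≗0 = refl
sumℕ-zero (suc n) f≗0 = cong₂ _+_ (f≗0 0) (sumℕ-zero n (f≗0 ∘ suc))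

+-assoc₄ : ∀ a b c d x → (a + (b + (c + (d + 0ℤ)))) + x ≡ a + (b + (c + (d + x)))
+-assoc₄ a b c d x = begin
  (a + (b + (c + (d + 0ℤ)))) + x  ≡⟨ ℤ.+-assoc a _ x ⟩
  a + ((b + (c + (d + 0ℤ))) + x)  ≡⟨ cong (λ z → a + z) (ℤ.+-assoc b _ x) ⟩
  a + (b + ((c + (d + 0ℤ)) + x))  ≡⟨ cong (λ z → a + (b + z)) (ℤ.+-assoc c _ x) ⟩
  a + (b + (c + ((d + 0ℤ) + x)))  ≡⟨ cong (λ z → a + (b + (c + (z + x)))) (ℤ.+-identityʳ d) ⟩
  a + (b + (c + (d + x)))         ∎

sumℕ-blocks : ∀ k (H : ℕ → Fin 4 → ℤ) →
              sumℕ (k ℕ.* 4) (λ x → H (x / 4) (x mod 4)) ≡ sumℕ k (λ m → sumFin 4 (H m))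
sumℕ-blocks zero    H = refl
sumℕ-blocks (suc k) H = begin
  h₀ + (h₁ + (h₂ + (h₃ + sumℕ (k ℕ.* 4) (λ x → H ((4 ℕ.+ x) / 4) (x mod 4)))))
    ≡⟨ cong (λ z → h₀ + (h₁ + (h₂ + (h₃ + z)))) (begin
         sumℕ (k ℕ.* 4) (λ x → H ((4 ℕ.+ x) / 4) (x mod 4))
           ≡⟨ sumℕ-cong (k ℕ.* 4) (λ x → cong (λ q → H q (x mod 4)) (m/n≡1+[m∸n]/n (ℕ.m≤m+n 4 x))) ⟩
         sumℕ (k ℕ.* 4) (λ x → H (suc (x / 4)) (x mod 4))
           ≡⟨ sumℕ-blocks k (H ∘ suc) ⟩
         sumℕ k (λ m → sumFin 4 (H (suc m))) ∎) ⟩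
  h₀ + (h₁ + (h₂ + (h₃ + sumℕ k (λ m → sumFin 4 (H (suc m))))))
    ≡⟨ +-assoc₄ h₀ h₁ h₂ h₃ _ ⟨
  sumFin 4 (H 0) + sumℕ k (λ m → sumFin 4 (H (suc m))) ∎
  where
  h₀ h₁ h₂ h₃ : ℤ
  h₀ = H 0 zero
  h₁ = H 0 (suc zero)
  h₂ = H 0 (suc (suc zero))
  h₃ = H 0 (suc (suc (suc zero)))

sumSlots : ℕ → (Slot → ℤ) → ℤ
sumSlots i f = f (hub zero) + (f (hub (suc zero)) + sumℕ (suc i) (λ m → sumFin 4 (f ∘ layer m)))

sumSlots-cong : ∀ i {f g : Slot → ℤ} → (∀ R → f R ≡ g R) → sumSlots i f ≡ sumSlots i g
sumSlots-cong i f≗g =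
  cong₂ _+_ (f≗g _) (cong₂ _+_ (f≗g _) (sumℕ-cong (suc i) (λ m → sumFin-cong 4 (f≗g ∘ layer m))))

sumSlots-tail : ∀ j (f : Slot → ℤ) → (∀ m r → f (layer (suc (suc m)) r) ≡ 0ℤ) →
                sumSlots (suc j) f ≡ sumSlots 1 f
sumSlots-tail j f tail≡0 =
  cong (λ z → f (hub zero) + (f (hub (suc zero)) +
               (sumFin 4 (f ∘ layer 0) + (sumFin 4 (f ∘ layer 1) + z))))
       (sumℕ-zero j (λ m → sumFin-cong 4 (tail≡0 m)))

order≡2+[1+i]*4 : ∀ i → order i ≡ 2 ℕ.+ suc i ℕ.* 4
order≡2+[1+i]*4 i = trans (ℕ.+-comm (4 ℕ.* i) 6) (cong (6 ℕ.+_) (ℕ.*-comm 4 i))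

sumℕ-decode : ∀ i (f : Slot → ℤ) → sumℕ (order i) (f ∘ decode) ≡ sumSlots i f
sumℕ-decode i f = begin
  sumℕ (order i) (f ∘ decode)            ≡⟨ cong (λ n → sumℕ n (f ∘ decode)) (order≡2+[1+i]*4 i) ⟩
  sumℕ (2 ℕ.+ suc i ℕ.* 4) (f ∘ decode)  ≡⟨ cong (λ z → f (hub zero) + (f (hub (suc zero)) + z))
                                               (sumℕ-blocks (suc i) (λ m r → f (layer m r))) ⟩
  sumSlots i f                           ∎

gram : ℕ → Slot → Slot → ℤ
gram i X Y = sumSlots i (λ R → entry i R X * entry i R Y)

Smat-gram : ∀ i a b → (transpose (Smat i) ⊗ Smat i) a b ≡ gram i (decode (toℕ a)) (decode (toℕ b))
Smat-gram i a b = begin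
  sumFin (order i) (λ c → Sentry i (toℕ c) p * Sentry i (toℕ c) q)
    ≡⟨ sumFin-toℕ (order i) (λ c → Sentry i c p * Sentry i c q) ⟩
  sumℕ (order i) (λ c → Sentry i c p * Sentry i c q)
    ≡⟨ sumℕ-cong (order i) (λ c → cong₂ _*_ (Sentry≡entry i c p) (Sentry≡entry i c q)) ⟩
  sumℕ (order i) (λ c → entry i (decode c) (decode p) * entry i (decode c) (decode q))
    ≡⟨ sumℕ-decode i (λ R → entry i R (decode p) * entry i R (decode q)) ⟩
  gram i (decode p) (decode q) ∎
  where
  p q : ℕ
  p = toℕ a
  q = toℕ b

gram-sym : ∀ i X Y → gram i X Y ≡ gram i Y X
gram-sym i X Y = sumSlots-cong i (λ R → ℤ.*-comm (entry i R X) (entry i R Y))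

headGram : ℕ → Slot → Slot → ℤ
headGram i X Y = sumSlots 1 (λ R → entry i R X * entry i R Y)

gram≡headGram : ∀ j X Y → (∀ m r → entry (suc j) (layer (suc (suc m)) r) X ≡ 0ℤ) →
                gram (suc j) X Y ≡ headGram (suc j) X Y
gram≡headGram j X Y X-tail≡0 =
  sumSlots-tail j (λ R → entry (suc j) R X * entry (suc j) R Y)
    (λ m r → cong (_* entry (suc j) (layer (suc (suc m)) r) Y) (X-tail≡0 m r))

headGram-hub-hub : ∀ j s s' → headGram (suc j) (hub s) (hub s') ≡ + 4 * identity s s'
headGram-hub-hub j = decide²-≡ _

headGram-hub-layer : ∀ j n s s' → headGram (suc j) (hub s) (layer n s') ≡ 0ℤ
headGram-hub-layer j zero          = decide²-≡ _
headGram-hub-layer j (suc zero)    = decide²-≡ _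
headGram-hub-layer j (suc (suc n)) = decide²-≡ _

headGram-layer₀ : ∀ j s s' → headGram (suc j) (layer 0 s) (layer 0 s') ≡ + 4 * identity s s'
headGram-layer₀ j = decide²-≡ _

-- B C = 0 when i = 1, and B B = 0 when i > 1
headGram-layer₀-layer : ∀ j n s s' → headGram (suc j) (layer 0 s) (layer (suc n) s') ≡ 0ℤ
headGram-layer₀-layer zero    zero          = decide²-≡ _
headGram-layer₀-layer zero    (suc n)       = decide²-≡ _
headGram-layer₀-layer (suc j) zero          = decide²-≡ _
headGram-layer₀-layer (suc j) (suc zero)    = decide²-≡ _
headGram-layer₀-layer (suc j) (suc (suc n)) = decide²-≡ _

gram₁-layer₁ : ∀ s s' → gram 1 (layer 1 s) (layer 1 s') ≡ + 4 * identity s s'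
gram₁-layer₁ = decide²-≡ _

BᵀB≡AᵀA : ∀ s s' → sumFin 4 (λ r → Bᵐ r s * Bᵐ r s') ≡ sumFin 2 (λ r → Aᵐ r s * Aᵐ r s')
BᵀB≡AᵀA = decide²-≡ _

layer₀-hub-shift : ∀ k a b s s' →
  sumFin 4 (λ r → entry (suc k) (layer 0 r) (layer (suc a) s) * entry (suc k) (layer 0 r) (layer (suc b) s'))
  ≡ sumFin 2 (λ r → entry k (hub r) (layer a s) * entry k (hub r) (layer b s'))
layer₀-hub-shift k zero    zero    = BᵀB≡AᵀA
layer₀-hub-shift k zero    (suc b) = decide²-≡ _
layer₀-hub-shift k (suc a) b       = λ _ _ → refl

gram-shift : ∀ j a b s s' →
             gram (suc (suc j)) (layer (suc a) s) (layer (suc b) s') ≡ gram (suc j) (layer a s) (layer b s')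
gram-shift j a b s s' = begin
  0ℤ + (0ℤ + (layer₀Term + rest))  ≡⟨ trans (ℤ.+-identityˡ _) (ℤ.+-identityˡ _) ⟩
  layer₀Term + rest                ≡⟨ cong (_+ rest) (layer₀-hub-shift (suc j) a b s s') ⟩
  (hubTerm zero + (hubTerm (suc zero) + 0ℤ)) + rest
                                   ≡⟨ ℤ.+-assoc (hubTerm zero) _ rest ⟩
  hubTerm zero + ((hubTerm (suc zero) + 0ℤ) + rest)
                                   ≡⟨ cong (λ z → hubTerm zero + (z + rest)) (ℤ.+-identityʳ (hubTerm (suc zero))) ⟩
  gram (suc j) (layer a s) (layer b s') ∎
  where
  layer₀Term rest : ℤ
  layer₀Term = sumFin 4 (λ r → entry (suc (suc j)) (layer 0 r) (layer (suc a) s)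
                             * entry (suc (suc j)) (layer 0 r) (layer (suc b) s'))
  rest = sumℕ (suc (suc j)) (λ m → sumFin 4 (λ r → entry (suc j) (layer m r) (layer a s)
                                                 * entry (suc j) (layer m r) (layer b s')))
  hubTerm : Fin 2 → ℤ
  hubTerm r = entry (suc j) (hub r) (layer a s) * entry (suc j) (hub r) (layer b s')

δ : Slot → Slot → ℤ
δ (hub r)           (hub s)           = identity r s
δ (hub _)           (layer _ _)       = 0ℤ
δ (layer _ _)       (hub _)           = 0ℤ
δ (layer zero r)    (layer zero s)    = identity r s
δ (layer (suc m) r) (layer (suc n) s) = δ (layer m r) (layer n s)
δ (layer _ _)       (layer _ _)       = 0ℤ

InMatrix : ℕ → Slot → Set
InMatrix i (hub _)     = ⊤
InMatrix i (layer m _) = m ≤ i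

gram-orthogonal : ∀ j X Y → InMatrix (suc j) X → InMatrix (suc j) Y → gram (suc j) X Y ≡ + 4 * δ X Y
gram-orthogonal j (hub s) (hub s') _ _ =
  trans (gram≡headGram j (hub s) (hub s') (λ _ _ → refl)) (headGram-hub-hub j s s')
gram-orthogonal j (hub s) (layer n s') _ _ =
  trans (gram≡headGram j (hub s) (layer n s') (λ _ _ → refl)) (headGram-hub-layer j n s s')
gram-orthogonal j (layer n s) (hub s') _ _ =
  trans (gram-sym (suc j) (layer n s) (hub s'))
        (trans (gram≡headGram j (hub s') (layer n s) (λ _ _ → refl)) (headGram-hub-layer j n s' s))
gram-orthogonal j (layer zero s) (layer zero s') _ _ =
  trans (gram≡headGram j (layer 0 s) (layer 0 s') (λ _ _ → refl)) (headGram-layer₀ j s s')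
gram-orthogonal j (layer zero s) (layer (suc n) s') _ _ =
  trans (gram≡headGram j (layer 0 s) (layer (suc n) s') (λ _ _ → refl)) (headGram-layer₀-layer j n s s')
gram-orthogonal j (layer (suc m) s) (layer zero s') _ _ =
  trans (gram-sym (suc j) (layer (suc m) s) (layer 0 s'))
        (trans (gram≡headGram j (layer 0 s') (layer (suc m) s) (λ _ _ → refl)) (headGram-layer₀-layer j m s' s))
gram-orthogonal zero (layer (suc zero) s) (layer (suc zero) s') _ _ = gram₁-layer₁ s s'
gram-orthogonal zero (layer (suc (suc m)) s) (layer (suc n) s') (s≤s ()) _
gram-orthogonal zero (layer (suc m) s) (layer (suc (suc n)) s') _ (s≤s ())
gram-orthogonal (suc j) (layer (suc m) s) (layer (suc n) s') (s≤s m≤) (s≤s n≤) =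
  trans (gram-shift j m n s s') (gram-orthogonal j (layer m s) (layer n s') m≤ n≤)

identity-refl : ∀ {n} (a : Fin n) → identity a a ≡ 1ℤ
identity-refl a = cong (λ b → if b then 1ℤ else 0ℤ) (dec-true (a ≟ᶠ a) refl)

identity-≢ : ∀ {n} {a b : Fin n} → a ≢ b → identity a b ≡ 0ℤ
identity-≢ {a = a} {b} a≢b = cong (λ c → if c then 1ℤ else 0ℤ) (dec-false (a ≟ᶠ b) a≢b)

δ-refl : ∀ X → δ X X ≡ 1ℤ
δ-refl (hub r)           = identity-refl r
δ-refl (layer zero r)    = identity-refl r
δ-refl (layer (suc m) r) = δ-refl (layer m r)

δ-≢ : ∀ X Y → X ≢ Y → δ X Y ≡ 0ℤ
δ-≢ (hub r)           (hub s)           X≢Y = identity-≢ (X≢Y ∘ cong hub)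
δ-≢ (hub _)           (layer _ _)       _   = refl
δ-≢ (layer _ _)       (hub _)           _   = refl
δ-≢ (layer zero r)    (layer zero s)    X≢Y = identity-≢ (X≢Y ∘ cong (layer 0))
δ-≢ (layer (suc m) r) (layer (suc n) s) X≢Y = δ-≢ (layer m r) (layer n s) λ { refl → X≢Y refl }
δ-≢ (layer zero _)    (layer (suc _) _) _   = refl
δ-≢ (layer (suc _) _) (layer zero _)    _   = refl

layer-injective : ∀ {m n r s} → layer m r ≡ layer n s → m ≡ n × r ≡ s
layer-injective refl = refl , refl

decode-injective : ∀ p q → decode p ≡ decode q → p ≡ q
decode-injective zero          zero          _ = refl
decode-injective (suc zero)    (suc zero)    _ = refl
decode-injective (suc (suc x)) (suc (suc y)) e with layer-injective e
... | m≡n , r≡s = cong (2 ℕ.+_) (begin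
  x                              ≡⟨ DivMod.property (x divMod 4) ⟩
  toℕ (x mod 4) ℕ.+ x / 4 ℕ.* 4  ≡⟨ cong₂ (λ r m → toℕ r ℕ.+ m ℕ.* 4) r≡s m≡n ⟩
  toℕ (y mod 4) ℕ.+ y / 4 ℕ.* 4  ≡⟨ DivMod.property (y divMod 4) ⟨
  y                              ∎)
decode-injective zero          (suc zero)    ()
decode-injective zero          (suc (suc y)) ()
decode-injective (suc zero)    zero          ()
decode-injective (suc zero)    (suc (suc y)) ()
decode-injective (suc (suc x)) zero          ()
decode-injective (suc (suc x)) (suc zero)    ()

identity≡δ : ∀ {n} (a b : Fin n) → identity a b ≡ δ (decode (toℕ a)) (decode (toℕ b))
identity≡δ a b with a ≟ᶠ b
... | yes refl = sym (δ-refl (decode (toℕ a)))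
... | no  a≢b  = sym (δ-≢ _ _ (a≢b ∘ toℕ-injective ∘ decode-injective (toℕ a) (toℕ b)))

decode-inMatrix : ∀ i p → p < order i → InMatrix i (decode p)
decode-inMatrix i zero          _ = tt
decode-inMatrix i (suc zero)    _ = tt
decode-inMatrix i (suc (suc x)) p<order = ℕ.≤-pred (m<n*o⇒m/o<n (ℕ.≤-pred (ℕ.≤-pred p<2+[1+i]*4)))
  where
  p<2+[1+i]*4 : suc (suc x) < 2 ℕ.+ suc i ℕ.* 4
  p<2+[1+i]*4 = subst (suc (suc x) <_) (order≡2+[1+i]*4 i) p<order

Smat-orthogonal : ∀ j a b → (transpose (Smat (suc j)) ⊗ Smat (suc j)) a b ≡ + 4 * identity a b
Smat-orthogonal j a b = begin
  (transpose (Smat (suc j)) ⊗ Smat (suc j)) a b  ≡⟨ Smat-gram (suc j) a b ⟩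
  gram (suc j) (decode (toℕ a)) (decode (toℕ b))  ≡⟨ gram-orthogonal j _ _ (inMatrix a) (inMatrix b) ⟩
  + 4 * δ (decode (toℕ a)) (decode (toℕ b))       ≡⟨ cong (λ d → + 4 * d) (identity≡δ a b) ⟨
  + 4 * identity a b                              ∎
  where
  inMatrix : ∀ c → InMatrix (suc j) (decode (toℕ c))
  inMatrix c = decode-inMatrix (suc j) (toℕ c) (toℕ<n c)

tridiag-above : ∀ i m r s → suc m ≤ i → tridiag i m r (suc m) s ≡ Bᵐ r s
tridiag-above (suc i) zero    r s _         = refl
tridiag-above (suc i) (suc m) r s (s≤s m<i) = tridiag-above i m r s m<i

tridiag-corner : ∀ i r s → tridiag i i r i s ≡ Cᵐ r s
tridiag-corner zero    r s = refl
tridiag-corner (suc i) r s = tridiag-corner i r s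

data Support (i : ℕ) : ℕ → Fin 4 → ℕ → Fin 4 → Set where
  above  : ∀ {m r s} → suc m ≤ i → Bᵐ r s ≢ 0ℤ → Support i m r (suc m) s
  below  : ∀ {n r s} → suc n ≤ i → Bᵐ s r ≢ 0ℤ → Support i (suc n) r n s
  corner : ∀ {r s} → Cᵐ r s ≢ 0ℤ → Support i i r i s

support-suc : ∀ {i m r n s} → Support i m r n s → Support (suc i) (suc m) r (suc n) s
support-suc (above m<i b≢0) = above (s≤s m<i) b≢0
support-suc (below n<i b≢0) = below (s≤s n<i) b≢0
support-suc (corner c≢0)    = corner c≢0

tridiag-support : ∀ i m r n s → tridiag i m r n s ≢ 0ℤ → Support i m r n s
tridiag-support zero    zero          r zero          s t≢0 = corner t≢0
tridiag-support zero    zero          r (suc n)       s t≢0 = ⊥-elim (t≢0 refl)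
tridiag-support zero    (suc m)       r n             s t≢0 = ⊥-elim (t≢0 refl)
tridiag-support (suc i) zero          r zero          s t≢0 = ⊥-elim (t≢0 refl)
tridiag-support (suc i) zero          r (suc zero)    s t≢0 = above (s≤s z≤n) t≢0
tridiag-support (suc i) zero          r (suc (suc n)) s t≢0 = ⊥-elim (t≢0 refl)
tridiag-support (suc i) (suc m)       r (suc n)       s t≢0 = support-suc (tridiag-support i m r n s t≢0)
tridiag-support (suc i) (suc zero)    r zero          s t≢0 = below (s≤s z≤n) (t≢0 ∘ cong -_)
tridiag-support (suc i) (suc (suc m)) r zero          s t≢0 = ⊥-elim (t≢0 refl)

label : Slot → Lab
label (hub zero)                       = lu
label (hub (suc zero))                 = lv
label (layer m zero)                   = lU (2 ℕ.* m ℕ.+ 1)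
label (layer m (suc zero))             = lU (2 ℕ.* m ℕ.+ 2)
label (layer m (suc (suc zero)))       = lV (2 ℕ.* m ℕ.+ 1)
label (layer m (suc (suc (suc zero)))) = lV (2 ℕ.* m ℕ.+ 2)

labelAt≡label∘decode : ∀ p → labelAt p ≡ label (decode p)
labelAt≡label∘decode zero          = refl
labelAt≡label∘decode (suc zero)    = refl
labelAt≡label∘decode (suc (suc p)) with p mod 4
... | zero                   = refl
... | suc zero               = refl
... | suc (suc zero)         = refl
... | suc (suc (suc zero))   = refl

2m+1≡2[1+m]∸1 : ∀ m → 2 ℕ.* m ℕ.+ 1 ≡ 2 ℕ.* suc m ∸ 1
2m+1≡2[1+m]∸1 m = trans (ℕ.+-comm (2 ℕ.* m) 1) (cong (_∸ 1) (sym (ℕ.*-suc 2 m)))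

2m+2≡2[1+m] : ∀ m → 2 ℕ.* m ℕ.+ 2 ≡ 2 ℕ.* suc m
2m+2≡2[1+m] m = trans (ℕ.+-comm (2 ℕ.* m) 2) (sym (ℕ.*-suc 2 m))

InPair : ℕ → ℕ → Set
InPair m a = a ≡ 2 ℕ.* m ℕ.+ 1 ⊎ a ≡ 2 ℕ.* m ℕ.+ 2

inPair⇒edgeEnd : ∀ {m a} → InPair m a → a ≡ 2 ℕ.* suc m ∸ 1 ⊎ a ≡ 2 ℕ.* suc m
inPair⇒edgeEnd {m} (inj₁ refl) = inj₁ (2m+1≡2[1+m]∸1 m)
inPair⇒edgeEnd {m} (inj₂ refl) = inj₂ (2m+2≡2[1+m] m)

edgeEnd⇒inPair : ∀ {m a} → a ≡ 2 ℕ.* suc m ∸ 1 ⊎ a ≡ 2 ℕ.* suc m → InPair m a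
edgeEnd⇒inPair {m} (inj₁ a≡) = inj₁ (trans a≡ (sym (2m+1≡2[1+m]∸1 m)))
edgeEnd⇒inPair {m} (inj₂ a≡) = inj₂ (trans a≡ (sym (2m+2≡2[1+m] m)))

uu-edge : ∀ {i m a b} → suc m ≤ i → InPair m a → InPair (suc m) b → Edge i (lU a) (lU b)
uu-edge m<i a∈ b∈ = e-UU (suc _) _ _ (s≤s z≤n) m<i (inPair⇒edgeEnd a∈) b∈

vv-edge : ∀ {i m a b} → suc m ≤ i → InPair m a → InPair (suc m) b → Edge i (lV a) (lV b)
vv-edge m<i a∈ b∈ = e-VV (suc _) _ _ (s≤s z≤n) m<i (inPair⇒edgeEnd a∈) b∈

hub-neighbour : ∀ s → Hub (label (layer 0 s))
hub-neighbour zero                   = hU1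
hub-neighbour (suc zero)             = hU2
hub-neighbour (suc (suc zero))       = hV1
hub-neighbour (suc (suc (suc zero))) = hV2

hub-edge : ∀ i r s → Edge i (label (hub r)) (label (layer 0 s))
hub-edge i zero       s = e-u (hub-neighbour s)
hub-edge i (suc zero) s = e-v (hub-neighbour s)

B-edge : ∀ i m r s → suc m ≤ i → Bᵐ r s ≢ 0ℤ → Edge i (label (layer m r)) (label (layer (suc m) s))
B-edge i m zero                   zero                   m<i _   = uu-edge m<i (inj₁ refl) (inj₁ refl)
B-edge i m zero                   (suc zero)             m<i _   = uu-edge m<i (inj₁ refl) (inj₂ refl)
B-edge i m (suc zero)             zero                   m<i _   = uu-edge m<i (inj₂ refl) (inj₁ refl)
B-edge i m (suc zero)             (suc zero)             m<i _   = uu-edge m<i (inj₂ refl) (inj₂ refl)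
B-edge i m (suc (suc zero))       (suc (suc zero))       m<i _   = vv-edge m<i (inj₁ refl) (inj₁ refl)
B-edge i m (suc (suc zero))       (suc (suc (suc zero))) m<i _   = vv-edge m<i (inj₁ refl) (inj₂ refl)
B-edge i m (suc (suc (suc zero))) (suc (suc zero))       m<i _   = vv-edge m<i (inj₂ refl) (inj₁ refl)
B-edge i m (suc (suc (suc zero))) (suc (suc (suc zero))) m<i _   = vv-edge m<i (inj₂ refl) (inj₂ refl)
B-edge i m zero                   (suc (suc zero))       _   b≢0 = ⊥-elim (b≢0 refl)
B-edge i m zero                   (suc (suc (suc zero))) _   b≢0 = ⊥-elim (b≢0 refl)
B-edge i m (suc zero)             (suc (suc zero))       _   b≢0 = ⊥-elim (b≢0 refl)
B-edge i m (suc zero)             (suc (suc (suc zero))) _   b≢0 = ⊥-elim (b≢0 refl)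
B-edge i m (suc (suc zero))       zero                   _   b≢0 = ⊥-elim (b≢0 refl)
B-edge i m (suc (suc zero))       (suc zero)             _   b≢0 = ⊥-elim (b≢0 refl)
B-edge i m (suc (suc (suc zero))) zero                   _   b≢0 = ⊥-elim (b≢0 refl)
B-edge i m (suc (suc (suc zero))) (suc zero)             _   b≢0 = ⊥-elim (b≢0 refl)

C-adjacent : ∀ i r s → Cᵐ r s ≢ 0ℤ → AdjL i (label (layer i r)) (label (layer i s))
C-adjacent i zero                   (suc (suc zero))       _   = inj₂ e-4
C-adjacent i zero                   (suc (suc (suc zero))) _   = inj₁ e-1
C-adjacent i (suc zero)             (suc (suc zero))       _   = inj₁ e-3
C-adjacent i (suc zero)             (suc (suc (suc zero))) _   = inj₂ e-2
C-adjacent i (suc (suc zero))       zero                   _   = inj₁ e-4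
C-adjacent i (suc (suc zero))       (suc zero)             _   = inj₂ e-3
C-adjacent i (suc (suc (suc zero))) zero                   _   = inj₂ e-1
C-adjacent i (suc (suc (suc zero))) (suc zero)             _   = inj₁ e-2
C-adjacent i zero                   zero                   c≢0 = ⊥-elim (c≢0 refl)
C-adjacent i zero                   (suc zero)             c≢0 = ⊥-elim (c≢0 refl)
C-adjacent i (suc zero)             zero                   c≢0 = ⊥-elim (c≢0 refl)
C-adjacent i (suc zero)             (suc zero)             c≢0 = ⊥-elim (c≢0 refl)
C-adjacent i (suc (suc zero))       (suc (suc zero))       c≢0 = ⊥-elim (c≢0 refl)
C-adjacent i (suc (suc zero))       (suc (suc (suc zero))) c≢0 = ⊥-elim (c≢0 refl)
C-adjacent i (suc (suc (suc zero))) (suc (suc zero))       c≢0 = ⊥-elim (c≢0 refl)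
C-adjacent i (suc (suc (suc zero))) (suc (suc (suc zero))) c≢0 = ⊥-elim (c≢0 refl)

support-adjacent : ∀ {i m r n s} → Support i m r n s → AdjL i (label (layer m r)) (label (layer n s))
support-adjacent (above m<i b≢0) = inj₁ (B-edge _ _ _ _ m<i b≢0)
support-adjacent (below n<i b≢0) = inj₂ (B-edge _ _ _ _ n<i b≢0)
support-adjacent (corner c≢0)    = C-adjacent _ _ _ c≢0

entry≢0⇒adjacent : ∀ i X Y → entry i X Y ≢ 0ℤ → AdjL i (label X) (label Y)
entry≢0⇒adjacent i (hub r)           (hub s)           e≢0 = ⊥-elim (e≢0 refl)
entry≢0⇒adjacent i (hub r)           (layer zero s)    _   = inj₁ (hub-edge i r s)
entry≢0⇒adjacent i (hub r)           (layer (suc n) s) e≢0 = ⊥-elim (e≢0 refl)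
entry≢0⇒adjacent i (layer m r)       (layer n s)       e≢0 = support-adjacent (tridiag-support i m r n s e≢0)
entry≢0⇒adjacent i (layer zero r)    (hub s)           _   = inj₂ (hub-edge i s r)
entry≢0⇒adjacent i (layer (suc m) r) (hub s)           e≢0 = ⊥-elim (e≢0 refl)

halve : ℕ → ℕ × Fin 2
halve zero          = 0 , zero
halve (suc zero)    = 0 , suc zero
halve (suc (suc a)) = map₁ suc (halve a)

halve-2m : ∀ m → halve (2 ℕ.* m) ≡ (m , zero)
halve-2m zero    = refl
halve-2m (suc m) = trans (cong halve (ℕ.*-suc 2 m)) (cong (map₁ suc) (halve-2m m))

halve-1+2m : ∀ m → halve (suc (2 ℕ.* m)) ≡ (m , suc zero)
halve-1+2m zero    = refl
halve-1+2m (suc m) = trans (cong (halve ∘ suc) (ℕ.*-suc 2 m)) (cong (map₁ suc) (halve-1+2m m))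

layerAt : (Fin 2 → Fin 4) → ℕ × Fin 2 → Slot
layerAt side (m , t) = layer m (side t)

-- u_{2m+1}, u_{2m+2} sit at offsets 0, 1 of layer m and v_{2m+1}, v_{2m+2} at offsets 2, 3;
-- the labels u_0 and v_0 name no vertex and are sent to an arbitrary slot.
slotOf : Lab → Slot
slotOf lu           = hub zero
slotOf lv           = hub (suc zero)
slotOf (lU zero)    = hub zero
slotOf (lU (suc a)) = layerAt (_↑ˡ 2) (halve a)
slotOf (lV zero)    = hub zero
slotOf (lV (suc a)) = layerAt (2 ↑ʳ_) (halve a)

slotOf∘label : ∀ X → slotOf (label X) ≡ X
slotOf∘label (hub zero)                       = refl
slotOf∘label (hub (suc zero))                 = refl
slotOf∘label (layer m zero)                   =
  trans (cong (slotOf ∘ lU) (ℕ.+-comm (2 ℕ.* m) 1)) (cong (layerAt (_↑ˡ 2)) (halve-2m m))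
slotOf∘label (layer m (suc zero))             =
  trans (cong (slotOf ∘ lU) (ℕ.+-comm (2 ℕ.* m) 2)) (cong (layerAt (_↑ˡ 2)) (halve-1+2m m))
slotOf∘label (layer m (suc (suc zero)))       =
  trans (cong (slotOf ∘ lV) (ℕ.+-comm (2 ℕ.* m) 1)) (cong (layerAt (2 ↑ʳ_)) (halve-2m m))
slotOf∘label (layer m (suc (suc (suc zero)))) =
  trans (cong (slotOf ∘ lV) (ℕ.+-comm (2 ℕ.* m) 2)) (cong (layerAt (2 ↑ʳ_)) (halve-1+2m m))

slotOf-lU : ∀ k a → InPair k a → Σ (Fin 2) λ t → slotOf (lU a) ≡ layer k (t ↑ˡ 2)
slotOf-lU k _ (inj₁ refl) = zero     , slotOf∘label (layer k zero)
slotOf-lU k _ (inj₂ refl) = suc zero , slotOf∘label (layer k (suc zero))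

slotOf-lV : ∀ k a → InPair k a → Σ (Fin 2) λ t → slotOf (lV a) ≡ layer k (2 ↑ʳ t)
slotOf-lV k _ (inj₁ refl) = zero     , slotOf∘label (layer k (suc (suc zero)))
slotOf-lV k _ (inj₂ refl) = suc zero , slotOf∘label (layer k (suc (suc (suc zero))))

B-uu≢0 : ∀ (t t' : Fin 2) → Bᵐ (t ↑ˡ 2) (t' ↑ˡ 2) ≢ 0ℤ
B-uu≢0 = decide² (λ (t t' : Fin 2) → ¬? (Bᵐ (t ↑ˡ 2) (t' ↑ˡ 2) ≟ 0ℤ)) _

B-vv≢0 : ∀ (t t' : Fin 2) → Bᵐ (2 ↑ʳ t) (2 ↑ʳ t') ≢ 0ℤ
B-vv≢0 = decide² (λ (t t' : Fin 2) → ¬? (Bᵐ (2 ↑ʳ t) (2 ↑ʳ t') ≟ 0ℤ)) _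

subst-entry≢0 : ∀ {i X X' Y Y'} → X ≡ X' → Y ≡ Y' → entry i X Y ≢ 0ℤ → entry i X' Y' ≢ 0ℤ
subst-entry≢0 refl refl e≢0 = e≢0

above≢0 : ∀ {i m r s} → suc m ≤ i → Bᵐ r s ≢ 0ℤ → entry i (layer m r) (layer (suc m) s) ≢ 0ℤ
above≢0 m<i b≢0 = b≢0 ∘ trans (sym (tridiag-above _ _ _ _ m<i))

corner≢0 : ∀ i {r s} → Cᵐ r s ≢ 0ℤ → entry i (layer i r) (layer i s) ≢ 0ℤ
corner≢0 i c≢0 = c≢0 ∘ trans (sym (tridiag-corner i _ _))

corner-edge≢0 : ∀ i r s → Cᵐ r s ≢ 0ℤ →
                entry i (slotOf (label (layer i r))) (slotOf (label (layer i s))) ≢ 0ℤ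
corner-edge≢0 i r s c≢0 =
  subst-entry≢0 (sym (slotOf∘label (layer i r))) (sym (slotOf∘label (layer i s))) (corner≢0 i c≢0)

edge⇒entry≢0 : ∀ i {x y} → Edge i x y → entry i (slotOf x) (slotOf y) ≢ 0ℤ
edge⇒entry≢0 i (e-u hU1) ()
edge⇒entry≢0 i (e-u hU2) ()
edge⇒entry≢0 i (e-u hV1) ()
edge⇒entry≢0 i (e-u hV2) ()
edge⇒entry≢0 i (e-v hU1) ()
edge⇒entry≢0 i (e-v hU2) ()
edge⇒entry≢0 i (e-v hV1) ()
edge⇒entry≢0 i (e-v hV2) ()
edge⇒entry≢0 i (e-UU (suc k) a b (s≤s z≤n) k<i a∈ b∈)
  with slotOf-lU k a (edgeEnd⇒inPair a∈) | slotOf-lU (suc k) b b∈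
... | t , a↦ | t' , b↦ = subst-entry≢0 (sym a↦) (sym b↦) (above≢0 k<i (B-uu≢0 t t'))
edge⇒entry≢0 i (e-VV (suc k) a b (s≤s z≤n) k<i a∈ b∈)
  with slotOf-lV k a (edgeEnd⇒inPair a∈) | slotOf-lV (suc k) b b∈
... | t , a↦ | t' , b↦ = subst-entry≢0 (sym a↦) (sym b↦) (above≢0 k<i (B-vv≢0 t t'))
edge⇒entry≢0 i e-1 = corner-edge≢0 i zero                   (suc (suc (suc zero))) (λ ())
edge⇒entry≢0 i e-2 = corner-edge≢0 i (suc (suc (suc zero))) (suc zero)             (λ ())
edge⇒entry≢0 i e-3 = corner-edge≢0 i (suc zero)             (suc (suc zero))       (λ ())
edge⇒entry≢0 i e-4 = corner-edge≢0 i (suc (suc zero))       zero                   (λ ())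

adjacent⇒entry≢0 : ∀ i X Y → AdjL i (label X) (label Y) → entry i X Y ≢ 0ℤ
adjacent⇒entry≢0 i X Y (inj₁ e) = subst-entry≢0 (slotOf∘label X) (slotOf∘label Y) (edge⇒entry≢0 i e)
adjacent⇒entry≢0 i X Y (inj₂ e) e≡0 =
  subst-entry≢0 (slotOf∘label Y) (slotOf∘label X) (edge⇒entry≢0 i e)
    (trans (entry-skew i X Y) (cong -_ e≡0))


module _ (i : ℕ) where

  slot : Fin (order i) → Slot
  slot a = decode (toℕ a)

  entry≡Smat : ∀ a b → entry i (slot a) (slot b) ≡ Smat i a b
  entry≡Smat a b = sym (Sentry≡entry i (toℕ a) (toℕ b))

  Smat-skew : ∀ a b → Smat i b a ≡ - Smat i a b
  Smat-skew a b = begin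
    Smat i b a                  ≡⟨ entry≡Smat b a ⟨
    entry i (slot b) (slot a)   ≡⟨ entry-skew i (slot a) (slot b) ⟩
    - entry i (slot a) (slot b) ≡⟨ cong -_ (entry≡Smat a b) ⟩
    - Smat i a b                ∎

  Smat-zeroOrUnit : ∀ a b → ZeroOrUnit (Smat i a b)
  Smat-zeroOrUnit a b = subst ZeroOrUnit (entry≡Smat a b) (entry-zeroOrUnit i (slot a) (slot b))

  Adj𝒢⇒AdjL : ∀ a b → Adj𝒢 i a b → AdjL i (label (slot a)) (label (slot b))
  Adj𝒢⇒AdjL a b = subst₂ (AdjL i) (labelAt≡label∘decode (toℕ a)) (labelAt≡label∘decode (toℕ b))

  AdjL⇒Adj𝒢 : ∀ a b → AdjL i (label (slot a)) (label (slot b)) → Adj𝒢 i a b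
  AdjL⇒Adj𝒢 a b = subst₂ (AdjL i) (sym (labelAt≡label∘decode (toℕ a))) (sym (labelAt≡label∘decode (toℕ b)))

  Adj𝒢⇒Smat≢0 : ∀ a b → Adj𝒢 i a b → Smat i a b ≢ 0ℤ
  Adj𝒢⇒Smat≢0 a b = subst (_≢ 0ℤ) (entry≡Smat a b) ∘ adjacent⇒entry≢0 i (slot a) (slot b) ∘ Adj𝒢⇒AdjL a b

  Smat≢0⇒Adj𝒢 : ∀ a b → Smat i a b ≢ 0ℤ → Adj𝒢 i a b
  Smat≢0⇒Adj𝒢 a b = AdjL⇒Adj𝒢 a b ∘ entry≢0⇒adjacent i (slot a) (slot b) ∘ subst (_≢ 0ℤ) (sym (entry≡Smat a b))

theorem3p5 : (i : ℕ) → 1 ≤ i →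
    Σ (Orientation (Adj𝒢 i)) (λ σ → IsSkewAdjacency σ (Smat i))
    × (∀ a b → (transpose (Smat i) ⊗ Smat i) a b ≡ + 4 * identity a b)
theorem3p5 (suc j) _ =
  skewSignMatrix⇒skewAdjacency (Smat i) (Smat-skew i) (Smat-zeroOrUnit i)
    (Adj𝒢⇒Smat≢0 i) (Smat≢0⇒Adj𝒢 i)
  , Smat-orthogonal j
  where
  i : ℕ
  i = suc j
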